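{- Let $d\geq 4$ be an integer, let $$P_d^{[2,d-2]}=\{p\in 2^d \mid 2\leq \mathrm{card}(\{i \mid p_i=1\})\leq d-2\},$$ and let $P=P_d^{[2,d-2]}\setminus\{(0,\dots,0,1,1),\,(1,\dots,1,0,0)\}$, where $(0,\dots,0,1,1)$ is the $d$-tuple whose first $d-2$ coordinates are $0$ and whose last two coordinates are $1$, and $(1,\dots,1,0,0)$ is the same with $0$ and $1$ interchanged; $P$ is regarded as a subposet of $2^d$. Then $\dim(P)\leq d-2$. Hence every subposet of $P$ has dimension at most $d-2$; in particular, for integers $a,b$ with $3\leq a<b\leq d-3$, the subposet $P_d^{a,b}$ of $2^d$ consisting of the elements with exactly $a$ or exactly $b$ coordinates equal to $1$ satisfies $\dim(P_d^{a,b})\leq d-2$.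
   Context: Posets are nonempty. $2$ denotes the chain $\{0,1\}$ with $0<1$ and $2^d$ the $d$-fold product with the componentwise order. The dimension $\dim(Q)$ of a poset $Q$ is the least cardinal $\kappa$ such that $Q$ order-embeds into a product of $\kappa$ chains (equivalently, the order of $Q$ is an intersection of $\kappa$ total orders on its underlying set). -}

module Defs where

open import Level using (0ℓ)
open import Data.Bool using (Bool; true; false; not; _≤_)
open import Data.Nat using (ℕ; zero; suc; _∸_) renaming (_≤_ to _≤ℕ_)
open import Data.Nat.Properties using (_≤?_)
open import Data.Fin using (Fin; toℕ)
open import Data.Vec using (Vec; []; _∷_; tabulate; map)
open import Data.Vec.Relation.Binary.Pointwise.Inductive using (Pointwise)
open import Data.Product using (Σ; _×_)
open import Data.Sum using (_⊎_)
open import Relation.Nullary using (¬_; does)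
open import Relation.Binary.PropositionalEquality using (_≡_; _≢_)
open import Relation.Binary.Bundles using (TotalOrder)
open import Function.Bundles using (_⇔_)

Cube : ℕ → Set
Cube d = Vec Bool d

_⊑_ : ∀ {d} → Cube d → Cube d → Set
_⊑_ = Pointwise _≤_

ones : ∀ {d} → Cube d → ℕ
ones [] = 0
ones (true ∷ p) = suc (ones p)
ones (false ∷ p) = ones p

-- A subposet of 2^d is given by a subset (predicate) with the induced order.
Subset : ℕ → Set₁
Subset d = Cube d → Set

Elem : ∀ {d} → Subset d → Set
Elem {d} S = Σ (Cube d) S

-- dim(S) ≤ k : S order-embeds into a product of k chains (componentwise order).
DimAtMost : ∀ {d} → Subset d → ℕ → Set₁
DimAtMost S k =
  Σ (Fin k → TotalOrder 0ℓ 0ℓ 0ℓ) λ C →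
  Σ ((i : Fin k) → Elem S → TotalOrder.Carrier (C i)) λ f →
  (x y : Elem S) →
    (Σ.proj₁ x ⊑ Σ.proj₁ y) ⇔ ((i : Fin k) → TotalOrder._≤_ (C i) (f i x) (f i y))

-- (0,…,0,1,1): first d-2 coordinates 0, last two 1.
lowTwo : (d : ℕ) → Cube d
lowTwo d = tabulate (λ i → does ((d ∸ 2) ≤? toℕ i))

highTwo : (d : ℕ) → Cube d
highTwo d = map not (lowTwo d)

Pmid : (d : ℕ) → Subset d
Pmid d p = (2 ≤ℕ ones p) × (ones p ≤ℕ d ∸ 2)

PP : (d : ℕ) → Subset d
PP d p = Pmid d p × (p ≢ lowTwo d) × (p ≢ highTwo d)

Pab : (d a b : ℕ) → Subset d
Pab d a b p = (ones p ≡ a) ⊎ (ones p ≡ b)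

module Submission where

open import Defs
open import Data.Nat using (ℕ; _≤_; _<_; _∸_)
open import Data.Product using (_×_)

open import Data.Bool using (Bool; true; false; not; f≤t; b≤b) renaming (_≤_ to _≤ᵇ_)
open import Data.Bool.Properties using (≤-minimum)
open import Data.Nat using (zero; suc; _+_; z≤n; s≤s)
open import Data.Nat.Properties using (≤-totalOrder; ≤-trans; <⇒≤; <-trans; <-irrefl; n≮n; _≤?_)
open import Data.Fin using (Fin; toℕ)
open import Data.Vec using (Vec; []; _∷_; _∷ʳ_; initLast; init; last; lookup; replicate; map)
open import Data.Vec.Properties
  using (init-∷ʳ; last-∷ʳ; map-∷ʳ; map-replicate; lookup-replicate; tabulate-cong)
open import Data.Vec.Relation.Binary.Pointwise.Inductive using (Pointwise; []; _∷_; Pointwise-≡⇒≡)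
import Data.Vec.Relation.Binary.Pointwise.Inductive as Pointwise
open import Data.Vec.Relation.Binary.Pointwise.Extensional using (ext; extensional⇒inductive)
open import Data.Product using (_,_; proj₁)
import Data.Product as Product
open import Data.Sum using (inj₁; inj₂)
open import Data.Empty using (⊥-elim)
open import Relation.Nullary using (does)
open import Relation.Binary.Core using (REL)
open import Relation.Binary.PropositionalEquality
open import Relation.Unary using (_⊆′_)
open import Function.Bundles using (mk⇔)
open ≡-Reasoning

-- For i < d - 2 compare x ∈ P through the value code(xᵢ, x_{d-1}, x_d) in the chain 0 < 1 < 2 < 3.
-- These d - 2 maps are monotone and recover xᵢ ≤ yᵢ.  They can miss x_{d-1} ≤ y_{d-1} only if
-- yᵢ = 1 for every i < d - 2, and since y has at most d - 2 ones this forces y = (1,…,1,0,0);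
-- symmetrically they can miss x_d ≤ y_d only if x = (0,…,0,1,1).  Hence they embed P into
-- d - 2 chains, and every subposet of P inherits the embedding.

bit : Bool → ℕ
bit false = 0
bit true  = 1

bit-mono : ∀ {a b} → a ≤ᵇ b → bit a ≤ bit b
bit-mono f≤t         = z≤n
bit-mono {false} b≤b = z≤n
bit-mono {true}  b≤b = s≤s z≤n

bit≤1 : ∀ a → bit a ≤ 1
bit≤1 false = z≤n
bit≤1 true  = s≤s z≤n

code : Bool → Bool → Bool → ℕ
code false p q = bit p
code true  p q = 2 + bit q

code-mono : ∀ {c c′ p p′ q q′} → c ≤ᵇ c′ → p ≤ᵇ p′ → q ≤ᵇ q′ → code c p q ≤ code c′ p′ q′
code-mono {p = p} f≤t _ _    = ≤-trans (bit≤1 p) (s≤s z≤n)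
code-mono {false} b≤b p≤p′ _ = bit-mono p≤p′
code-mono {true}  b≤b _ q≤q′ = s≤s (s≤s (bit-mono q≤q′))

code-cancel-≤ : ∀ c c′ {p p′ q q′} → code c p q ≤ code c′ p′ q′ → c ≤ᵇ c′
code-cancel-≤ false c′    _ = ≤-minimum c′
code-cancel-≤ true  true  _ = b≤b
code-cancel-≤ true  false {p′ = false} ()
code-cancel-≤ true  false {p′ = true} (s≤s ())

code-pen-drop : ∀ c c′ {q q′} → code c true q ≤ code c′ false q′ → c′ ≡ true
code-pen-drop c     true  _  = refl
code-pen-drop false false ()
code-pen-drop true  false ()

code-last-drop : ∀ c c′ {p p′} → code c p true ≤ code c′ p′ false → c ≡ false
code-last-drop false c′ _ = refl
code-last-drop true true (s≤s (s≤s ()))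
code-last-drop true false {p′ = false} ()
code-last-drop true false {p′ = true} (s≤s ())

data Snoc₂ {A : Set} {n : ℕ} : Vec A (2 + n) → Set where
  snoc₂ : (xs : Vec A n) (p q : A) → Snoc₂ (xs ∷ʳ p ∷ʳ q)

snoc₂-view : ∀ {A : Set} {n} (v : Vec A (2 + n)) → Snoc₂ v
snoc₂-view v with initLast v
... | u , q , refl with initLast u
...   | xs , p , refl = snoc₂ xs p q

module _ {a b ℓ} {A : Set a} {B : Set b} {R : REL A B ℓ} where

  Pointwise-∷ʳ⁺ : ∀ {n} {xs : Vec A n} {ys : Vec B n} {x y} →
                  Pointwise R xs ys → R x y → Pointwise R (xs ∷ʳ x) (ys ∷ʳ y)
  Pointwise-∷ʳ⁺ []       rxy = rxy ∷ []
  Pointwise-∷ʳ⁺ (r ∷ rs) rxy = r ∷ Pointwise-∷ʳ⁺ rs rxy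

  Pointwise-∷ʳ⁻ : ∀ {n} (xs : Vec A n) (ys : Vec B n) {x y} →
                  Pointwise R (xs ∷ʳ x) (ys ∷ʳ y) → Pointwise R xs ys × R x y
  Pointwise-∷ʳ⁻ []       []       (rxy ∷ []) = [] , rxy
  Pointwise-∷ʳ⁻ (_ ∷ xs) (_ ∷ ys) (r ∷ rs)   = Product.map₁ (r ∷_) (Pointwise-∷ʳ⁻ xs ys rs)

lookup-const⇒replicate : ∀ {A : Set} {n} {xs : Vec A n} {x} →
                         (∀ i → lookup xs i ≡ x) → xs ≡ replicate n x
lookup-const⇒replicate {x = x} h =
  Pointwise-≡⇒≡ (extensional⇒inductive (ext λ i → trans (h i) (sym (lookup-replicate i x))))

ones-∷ʳ : ∀ {n} (xs : Vec Bool n) b → ones (xs ∷ʳ b) ≡ ones (b ∷ xs)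
ones-∷ʳ []           b     = refl
ones-∷ʳ (false ∷ xs) false = ones-∷ʳ xs false
ones-∷ʳ (false ∷ xs) true  = ones-∷ʳ xs true
ones-∷ʳ (true ∷ xs)  false = cong suc (ones-∷ʳ xs false)
ones-∷ʳ (true ∷ xs)  true  = cong suc (ones-∷ʳ xs true)

ones-∷ʳ² : ∀ {n} (xs : Vec Bool n) p q → ones (xs ∷ʳ p ∷ʳ q) ≡ ones (q ∷ p ∷ xs)
ones-∷ʳ² xs p false = trans (ones-∷ʳ (xs ∷ʳ p) false) (ones-∷ʳ xs p)
ones-∷ʳ² xs p true  = trans (ones-∷ʳ (xs ∷ʳ p) true) (cong suc (ones-∷ʳ xs p))

ones-replicate-true : ∀ n → ones (replicate n true) ≡ n
ones-replicate-true zero    = refl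
ones-replicate-true (suc n) = cong suc (ones-replicate-true n)

ones-replicate-false : ∀ n → ones (replicate n false) ≡ 0
ones-replicate-false zero    = refl
ones-replicate-false (suc n) = ones-replicate-false n

does-s≤?s : ∀ m n → does (suc m ≤? suc n) ≡ does (m ≤? n)
does-s≤?s zero    n = refl
does-s≤?s (suc m) n = refl

lowTwo-∷ʳ : ∀ n → lowTwo (2 + n) ≡ replicate n false ∷ʳ true ∷ʳ true
lowTwo-∷ʳ zero    = refl
lowTwo-∷ʳ (suc n) =
  cong (false ∷_) (trans (tabulate-cong (λ i → does-s≤?s n (toℕ i))) (lowTwo-∷ʳ n))

highTwo-∷ʳ : ∀ n → highTwo (2 + n) ≡ replicate n true ∷ʳ false ∷ʳ false
highTwo-∷ʳ n = begin
  map not (lowTwo (2 + n))                            ≡⟨ cong (map not) (lowTwo-∷ʳ n) ⟩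
  map not (replicate n false ∷ʳ true ∷ʳ true)         ≡⟨ map-∷ʳ not true (replicate n false ∷ʳ true) ⟩
  map not (replicate n false ∷ʳ true) ∷ʳ false        ≡⟨ cong (_∷ʳ false) (map-∷ʳ not true (replicate n false)) ⟩
  map not (replicate n false) ∷ʳ false ∷ʳ false       ≡⟨ cong (λ xs → xs ∷ʳ false ∷ʳ false) (map-replicate not false n) ⟩
  replicate n true ∷ʳ false ∷ʳ false                  ∎

ones-lowTwo : ∀ n → ones (lowTwo (2 + n)) ≡ 2
ones-lowTwo n = begin
  ones (lowTwo (2 + n))                          ≡⟨ cong ones (lowTwo-∷ʳ n) ⟩
  ones (replicate n false ∷ʳ true ∷ʳ true)       ≡⟨ ones-∷ʳ² (replicate n false) true true ⟩
  2 + ones (replicate n false)                   ≡⟨ cong (2 +_) (ones-replicate-false n) ⟩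
  2                                              ∎

ones-highTwo : ∀ n → ones (highTwo (2 + n)) ≡ n
ones-highTwo n = begin
  ones (highTwo (2 + n))                         ≡⟨ cong ones (highTwo-∷ʳ n) ⟩
  ones (replicate n true ∷ʳ false ∷ʳ false)      ≡⟨ ones-∷ʳ² (replicate n true) false false ⟩
  ones (replicate n true)                        ≡⟨ ones-replicate-true n ⟩
  n                                              ∎

top-front⇒highTwo : ∀ {n} {ys : Vec Bool n} {q} → (∀ i → lookup ys i ≡ true) →
                    ones (ys ∷ʳ false ∷ʳ q) ≤ n → ys ∷ʳ false ∷ʳ q ≡ highTwo (2 + n)
top-front⇒highTwo {ys = ys} h _ with lookup-const⇒replicate {xs = ys} h
top-front⇒highTwo {n} {q = false} _ _     | refl = sym (highTwo-∷ʳ n)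
top-front⇒highTwo {n} {q = true}  _ light | refl =
  ⊥-elim (n≮n n (subst (_≤ n) ones≡1+n light))
  where
  ones≡1+n : ones (replicate n true ∷ʳ false ∷ʳ true) ≡ suc n
  ones≡1+n = trans (ones-∷ʳ² (replicate n true) false true) (cong suc (ones-replicate-true n))

bottom-front⇒lowTwo : ∀ {n} {xs : Vec Bool n} {p} → (∀ i → lookup xs i ≡ false) →
                      2 ≤ ones (xs ∷ʳ p ∷ʳ true) → xs ∷ʳ p ∷ʳ true ≡ lowTwo (2 + n)
bottom-front⇒lowTwo {xs = xs} h _ with lookup-const⇒replicate {xs = xs} h
bottom-front⇒lowTwo {n} {p = true}  _ _     | refl = sym (lowTwo-∷ʳ n)
bottom-front⇒lowTwo {n} {p = false} _ heavy | refl =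
  ⊥-elim (n≮n 1 (subst (2 ≤_) ones≡1 heavy))
  where
  ones≡1 : ones (replicate n false ∷ʳ false ∷ʳ true) ≡ 1
  ones≡1 = trans (ones-∷ʳ² (replicate n false) false true) (cong suc (ones-replicate-false n))

module _ {n : ℕ} (xs ys : Vec Bool n) where

  pen-≤ : ∀ p p′ {q q′} → (∀ i → code (lookup xs i) p q ≤ code (lookup ys i) p′ q′) →
          ones (ys ∷ʳ p′ ∷ʳ q′) ≤ n → ys ∷ʳ p′ ∷ʳ q′ ≢ highTwo (2 + n) → p ≤ᵇ p′
  pen-≤ false p′    _ _ _ = ≤-minimum p′
  pen-≤ true  true  _ _ _ = b≤b
  pen-≤ true  false h light ≢highTwo =
    ⊥-elim (≢highTwo (top-front⇒highTwo (λ i → code-pen-drop (lookup xs i) (lookup ys i) (h i)) light))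

  last-≤ : ∀ {p p′} q q′ → (∀ i → code (lookup xs i) p q ≤ code (lookup ys i) p′ q′) →
           2 ≤ ones (xs ∷ʳ p ∷ʳ q) → xs ∷ʳ p ∷ʳ q ≢ lowTwo (2 + n) → q ≤ᵇ q′
  last-≤ false q′    _ _ _ = ≤-minimum q′
  last-≤ true  true  _ _ _ = b≤b
  last-≤ true  false h heavy ≢lowTwo =
    ⊥-elim (≢lowTwo (bottom-front⇒lowTwo (λ i → code-last-drop (lookup xs i) (lookup ys i) (h i)) heavy))

module _ {n : ℕ} where

  embed : Fin n → Cube (2 + n) → ℕ
  embed i v = code (lookup (init (init v)) i) (last (init v)) (last v)

  embed-∷ʳ : ∀ (xs : Vec Bool n) p q i → embed i (xs ∷ʳ p ∷ʳ q) ≡ code (lookup xs i) p q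
  embed-∷ʳ xs p q i
    rewrite init-∷ʳ q (xs ∷ʳ p) | last-∷ʳ q (xs ∷ʳ p) | init-∷ʳ p xs | last-∷ʳ p xs = refl

  embed-mono : ∀ {v w} → v ⊑ w → ∀ i → embed i v ≤ embed i w
  embed-mono {v} {w} v⊑w i with snoc₂-view v | snoc₂-view w
  ... | snoc₂ xs p q | snoc₂ ys p′ q′ rewrite embed-∷ʳ xs p q i | embed-∷ʳ ys p′ q′ i =
    let xs∷ʳp⊑ys∷ʳp′ , q≤q′ = Pointwise-∷ʳ⁻ (xs ∷ʳ p) (ys ∷ʳ p′) v⊑w
        xs⊑ys , p≤p′        = Pointwise-∷ʳ⁻ xs ys xs∷ʳp⊑ys∷ʳp′
    in code-mono (Pointwise.lookup xs⊑ys i) p≤p′ q≤q′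

  embed-reflects : ∀ {v w} → 2 ≤ ones v → v ≢ lowTwo (2 + n) → ones w ≤ n → w ≢ highTwo (2 + n) →
                   (∀ i → embed i v ≤ embed i w) → v ⊑ w
  embed-reflects {v} {w} heavy ≢lowTwo light ≢highTwo h with snoc₂-view v | snoc₂-view w
  ... | snoc₂ xs p q | snoc₂ ys p′ q′ =
    Pointwise-∷ʳ⁺ (Pointwise-∷ʳ⁺ xs⊑ys (pen-≤ xs ys p p′ h′ light ≢highTwo))
                  (last-≤ xs ys q q′ h′ heavy ≢lowTwo)
    where
    h′ : ∀ i → code (lookup xs i) p q ≤ code (lookup ys i) p′ q′
    h′ i = subst₂ _≤_ (embed-∷ʳ xs p q i) (embed-∷ʳ ys p′ q′ i) (h i)
    xs⊑ys : Pointwise _≤ᵇ_ xs ys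
    xs⊑ys = extensional⇒inductive (ext λ i → code-cancel-≤ (lookup xs i) (lookup ys i) (h′ i))

DimAtMost-PP : ∀ n → DimAtMost (PP (2 + n)) n
DimAtMost-PP n =
  (λ _ → ≤-totalOrder) , (λ i x → embed i (proj₁ x)) ,
  λ (v , (heavy , _) , ≢lowTwo , _) (w , (_ , light) , _ , ≢highTwo) →
    mk⇔ embed-mono (embed-reflects heavy ≢lowTwo light ≢highTwo)

DimAtMost-⊆′ : ∀ {d k} {S Q : Subset d} → Q ⊆′ S → DimAtMost S k → DimAtMost Q k
DimAtMost-⊆′ Q⊆S (C , f , f-embeds) =
  C , (λ i (p , q) → f i (p , Q⊆S p q)) ,
  λ (p , q) (p′ , q′) → f-embeds (p , Q⊆S p q) (p′ , Q⊆S p′ q′)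

inner-layer⇒PP : ∀ n {p : Cube (2 + n)} → 2 < ones p → ones p < n → PP (2 + n) p
inner-layer⇒PP n 2<ones ones<n =
  (<⇒≤ 2<ones , <⇒≤ ones<n) ,
  (λ p≡lowTwo → <-irrefl (sym (ones-lowTwo n)) (subst (λ x → 2 < ones x) p≡lowTwo 2<ones)) ,
  (λ p≡highTwo → <-irrefl (ones-highTwo n) (subst (λ x → ones x < n) p≡highTwo ones<n))

Pab⊆PP : ∀ m {a b} → 3 ≤ a → a < b → b ≤ suc m → Pab (4 + m) a b ⊆′ PP (4 + m)
Pab⊆PP m 3≤a a<b b≤1+m _ (inj₁ refl) = inner-layer⇒PP (2 + m) 3≤a (s≤s (≤-trans (<⇒≤ a<b) b≤1+m))
Pab⊆PP m 3≤a a<b b≤1+m _ (inj₂ refl) = inner-layer⇒PP (2 + m) (<-trans 3≤a a<b) (s≤s b≤1+m)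

corollary2p5 : (d : ℕ) → 4 ≤ d →
    DimAtMost (PP d) (d ∸ 2)
    × ((Q : Subset d) → (∀ p → Q p → PP d p) → DimAtMost Q (d ∸ 2))
    × ((a b : ℕ) → 3 ≤ a → a < b → b ≤ d ∸ 3 → DimAtMost (Pab d a b) (d ∸ 2))
corollary2p5 (suc (suc (suc (suc m)))) (s≤s (s≤s (s≤s (s≤s _)))) =
  dimPP ,
  (λ Q Q⊆PP → DimAtMost-⊆′ Q⊆PP dimPP) ,
  (λ a b 3≤a a<b b≤d∸3 → DimAtMost-⊆′ (Pab⊆PP m 3≤a a<b b≤d∸3) dimPP)
  where
  dimPP : DimAtMost (PP (4 + m)) (2 + m)
  dimPP = DimAtMost-PP (2 + m)
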